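{- Let $k\geq 2$ and let $\mathcal{S}$ be a non-trivial simplicial $k$-circuit. Then (a) $G(\mathcal{S})$ is $(k+1)$-connected; and (b) if $X$ is a $(k+1)$-vertex separator of $G(\mathcal{S})$, then $X$ is a non-facial $(k+1)$-clique of $G(\mathcal{S})$ and there are simplicial $k$-circuits $\mathcal{S}'$ and $\mathcal{S}''$ such that $\mathcal{S}'\cap\mathcal{S}''=\{X\}$ and $\mathcal{S}=\mathcal{S}'\triangle\mathcal{S}''$.
   Context: A simplicial $k$-multicomplex is a finite multiset of $(k+1)$-element sets ($k$-simplices); $V(\mathcal{S})$ is the union of its members and $G(\mathcal{S})$ is the simple graph on $V(\mathcal{S})$ with edge $uv$ whenever $\{u,v\}$ lies in some member. $\mathcal{S}$ is a simplicial $k$-cycle if every $k$-element set lies in an even number (with multiplicity) of members; a simplicial $k$-circuit is a nonempty simplicial $k$-cycle with no nonempty proper sub-multiset that is a simplicial $k$-cycle. It is trivial if it consists of two copies of the same $k$-simplex; non-trivial circuits have no repeated simplices. A $(k+1)$-vertex separator is a set $X$ of $k+1$ vertices with $G-X$ disconnected. A non-facial $(k+1)$-clique of $G(\mathcal{S})$ is a set of $k+1$ pairwise adjacent vertices which is not a member of $\mathcal{S}$. $\triangle$ denotes symmetric difference. -}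

module Defs where

open import Data.Nat using (ℕ; _≤_; _⊓_; ∣_-_∣)
open import Data.Nat.Properties using () renaming (_≟_ to _≟ℕ_)
open import Data.Bool using () renaming (_≟_ to _≟B_)
open import Data.Fin using (Fin)
open import Data.Fin.Subset using (Subset; _∈_; _∉_; _⊆_; _∪_; ⊥; ∣_∣)
open import Data.Fin.Subset.Properties using (_⊆?_)
open import Data.Vec.Properties using (≡-dec)
open import Data.List using (List; []; _∷_; filter; length; foldr)
open import Data.List.Relation.Unary.All using (All)
open import Data.List.Relation.Unary.Any using (Any)
open import Data.Nat.Divisibility using (_∣_)
open import Data.Product using (_×_; ∃)
open import Relation.Binary.PropositionalEquality using (_≡_; _≢_)
open import Relation.Nullary using (¬_; Dec; yes; no)

-- Vertices are drawn from Fin n (any finite multicomplex can be relabelled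
-- so that its vertex set lies in some Fin n); a simplex is a Subset n.

_≟S_ : ∀ {n} (σ τ : Subset n) → Dec (σ ≡ τ)
_≟S_ = ≡-dec _≟B_

-- A multiset of simplices is a list; multiplicity of σ in S
mult : ∀ {n} → Subset n → List (Subset n) → ℕ
mult σ S = length (filter (σ ≟S_) S)

cover : ∀ {n} → Subset n → List (Subset n) → ℕ
cover τ S = length (filter (τ ⊆?_) S)

IsMulticomplex : ∀ {n} (k : ℕ) → List (Subset n) → Set
IsMulticomplex k S = All (λ σ → ∣ σ ∣ ≡ ℕ.suc k) S

_⊑_ : ∀ {n} → List (Subset n) → List (Subset n) → Set
S' ⊑ S = ∀ σ → mult σ S' ≤ mult σ S

_≈M_ : ∀ {n} → List (Subset n) → List (Subset n) → Set
S' ≈M S = ∀ σ → mult σ S' ≡ mult σ S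

NonEmpty : ∀ {n} → List (Subset n) → Set
NonEmpty S = S ≢ []

IsCycle : ∀ {n} (k : ℕ) → List (Subset n) → Set
IsCycle k S = IsMulticomplex k S × (∀ τ → ∣ τ ∣ ≡ k → 2 ∣ cover τ S)

IsCircuit : ∀ {n} (k : ℕ) → List (Subset n) → Set
IsCircuit k S =
  NonEmpty S × IsCycle k S ×
  (∀ S' → S' ⊑ S → NonEmpty S' → IsCycle k S' → S' ≈M S)

IsTrivial : ∀ {n} → List (Subset n) → Set
IsTrivial S = ∃ λ σ → S ≈M (σ ∷ σ ∷ [])

V : ∀ {n} → List (Subset n) → Subset n
V S = foldr _∪_ ⊥ S

Adj : ∀ {n} → List (Subset n) → Fin n → Fin n → Set
Adj S u v = u ≢ v × Any (λ σ → u ∈ σ × v ∈ σ) S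

-- walks in G(S) - X (starting vertex assumed outside X by the user)
data Reach {n} (S : List (Subset n)) (X : Subset n) : Fin n → Fin n → Set where
  here : ∀ {u} → Reach S X u u
  step : ∀ {u v w} → Adj S u v → v ∉ X → Reach S X v w → Reach S X u w

ConnectedAvoiding : ∀ {n} → List (Subset n) → Subset n → Set
ConnectedAvoiding S X =
  ∀ u v → u ∈ V S → u ∉ X → v ∈ V S → v ∉ X → Reach S X u v

IsConnectedN : ∀ {n} (d : ℕ) → List (Subset n) → Set
IsConnectedN d S =
  ℕ.suc d ≤ ∣ V S ∣ × (∀ X → ℕ.suc ∣ X ∣ ≤ d → ConnectedAvoiding S X)

IsSeparator : ∀ {n} (k : ℕ) → List (Subset n) → Subset n → Set
IsSeparator k S X = X ⊆ V S × ∣ X ∣ ≡ ℕ.suc k × ¬ ConnectedAvoiding S X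

IsNonFacialClique : ∀ {n} (k : ℕ) → List (Subset n) → Subset n → Set
IsNonFacialClique k S X =
  ∣ X ∣ ≡ ℕ.suc k × (∀ u v → u ∈ X → v ∈ X → u ≢ v → Adj S u v) × mult X S ≡ 0

InterIsSingleton : ∀ {n} → List (Subset n) → List (Subset n) → Subset n → Set
InterIsSingleton S' S'' X = ∀ σ → mult σ S' ⊓ mult σ S'' ≡ mult σ (X ∷ [])

IsSymDiff : ∀ {n} → List (Subset n) → List (Subset n) → List (Subset n) → Set
IsSymDiff S S' S'' = ∀ σ → mult σ S ≡ ∣ mult σ S' - mult σ S'' ∣

-- Let X separate u from v in G(S), let C be the component of u in G(S) − X, and split S into the
-- simplices A that meet C and the remaining simplices B.  A simplex meeting C lies inside C ∪ X, so a
-- k-set with a vertex outside X is covered by A either exactly as often as by S or not at all: the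
-- mod-2 boundary ∂A is carried by the k-subsets of X.  For a (k−1)-set ρ, every simplex containing ρ
-- contains exactly two of the k-sets ρ ∪ {y}, so the covers of these k-sets have even sum; restricted
-- to y ∈ X this forces ∂A = 0 when |X| ≤ k, and forces all k-subsets of X to have the same parity in A
-- when |X| = k + 1.  A is a nonempty proper part of the circuit S, hence not a cycle, so |X| = k + 1
-- and ∂A = ∂B = ∂X.  Thus A + X and B + X are cycles, and minimality of S makes them circuits.
module Submission where

open import Defs
open import Data.Nat using (ℕ; _≤_)
open import Data.List using (List)
open import Data.Fin.Subset using (Subset)
open import Data.Product using (_×_; ∃₂)
open import Relation.Nullary using (¬_)

open import Data.Bool using (true; if_then_else_)
open import Data.Empty using (⊥; ⊥-elim)
open import Data.Fin using (Fin; zero; suc)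
import Data.Fin.Properties as Fin
open import Data.Fin.Subset
  using (inside; outside; _∈_; _∉_; _⊆_; _∪_; _∩_; _─_; _-_; ∁; ⁅_⁆; ∣_∣; Nonempty)
open import Data.Fin.Subset.Properties
open import Data.List using ([]; _∷_; _++_; filter; length; replicate)
open import Data.List.Membership.Propositional using (find; lose) renaming (_∈_ to _∈ₗ_)
open import Data.List.Properties using (filter-++; length-++; filter-some; filter-all)
open import Data.List.Relation.Unary.All as All using (All; []; _∷_)
open import Data.List.Relation.Unary.All.Properties using (++⁺; filter⁺)
open import Data.List.Relation.Unary.Any as Any using (Any)
open import Data.Nat using (zero; suc; parity; _+_; _*_; _<_; _⊓_; z≤n; s≤s; s≤s⁻¹; >-nonZero)
  renaming (∣_-_∣ to ∣_-ℕ_∣)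
open import Data.Nat.Divisibility using (_∣_; divides; ∣⇒≤)
open import Data.Nat.Properties
  using ( _≤?_; ≤-refl; ≤-reflexive; ≤-trans; <-irrefl; <⇒≱; <⇒≢; ≰⇒>; 1+n≰n; suc-injective
        ; +-suc; +-assoc; +-comm; +-identityʳ; +-cancelˡ-≡; +-cancelʳ-≡; +-monoˡ-≤; m≤m+n; m≤n+m
        ; m+n≡0⇒n≡0; *-comm; *-distribˡ-+; ⊓-zeroʳ; ∣-∣-identityʳ; +-commutativeSemigroup
        ; module ≤-Reasoning)
open import Algebra.Properties.CommutativeSemigroup +-commutativeSemigroup using (interchange; x∙yz≈y∙xz)
open import Data.Parity.Base as ℙ using (Parity; 0ℙ; 1ℙ)
import Data.Parity.Properties as ℙ
open import Data.Product using (_,_; ∃; proj₁; proj₂; uncurry)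
open import Data.Sum as Sum using (_⊎_; inj₁; inj₂)
open import Data.Vec using ([]; _∷_; here; there; tabulate)
open import Data.Vec.Properties using ([]=⇒lookup; lookup⇒[]=; lookup∘tabulate)
open import Function using (_∘_; _$_; flip)
open import Relation.Binary.PropositionalEquality
open import Relation.Nullary using (Dec; yes; no; does; ¬?; _×-dec_)
open import Relation.Nullary.Decidable using (decidable-stable; _→-dec_; dec-true; map′)
open import Relation.Unary using (Pred; Decidable)
open import Relation.Unary.Properties using (∁?)

private variable
  n : ℕ
  x y : Fin n
  p q : Subset n

module _ {a ℓ₁ ℓ₂} {A : Set a} {P : Pred A ℓ₁} {Q : Pred A ℓ₂} (Q? : Decidable Q) (P? : Decidable P) where

  count-filter-split : ∀ xs →
    length (filter Q? xs) ≡ length (filter Q? (filter P? xs)) + length (filter Q? (filter (∁? P?) xs))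
  count-filter-split [] = refl
  count-filter-split (x ∷ xs) with P? x
  ... | yes _ with Q? x
  ...   | yes _ = cong suc (count-filter-split xs)
  ...   | no _  = count-filter-split xs
  count-filter-split (x ∷ xs) | no _ with Q? x
  ...   | yes _ = trans (cong suc (count-filter-split xs)) (sym (+-suc _ _))
  ...   | no _  = count-filter-split xs

  count-filter-⊆ : ∀ {xs} → All (λ x → Q x → P x) xs →
    length (filter Q? (filter P? xs)) ≡ length (filter Q? xs)
  count-filter-⊆ [] = refl
  count-filter-⊆ {x ∷ _} (Q⇒P ∷ Q⇒Ps) with P? x
  ... | yes _ with Q? x
  ...   | yes _ = cong suc (count-filter-⊆ Q⇒Ps)
  ...   | no _  = count-filter-⊆ Q⇒Ps
  count-filter-⊆ {x ∷ _} (Q⇒P ∷ Q⇒Ps) | no ¬Px with Q? x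
  ...   | yes Qx = ⊥-elim (¬Px (Q⇒P Qx))
  ...   | no _   = count-filter-⊆ Q⇒Ps

  count-filter-disjoint : ∀ {xs} → All (λ x → Q x → ¬ P x) xs →
    length (filter Q? (filter P? xs)) ≡ 0
  count-filter-disjoint [] = refl
  count-filter-disjoint {x ∷ _} (Q⇒¬P ∷ Q⇒¬Ps) with P? x
  ... | no _ = count-filter-disjoint Q⇒¬Ps
  ... | yes Px with Q? x
  ...   | yes Qx = ⊥-elim (Q⇒¬P Qx Px)
  ...   | no _   = count-filter-disjoint Q⇒¬Ps

module _ {a ℓ} {A : Set a} {P : Pred A ℓ} (P? : Decidable P) where

  count>0⇒Any : ∀ {xs} → 0 < length (filter P? xs) → Any P xs
  count>0⇒Any {x ∷ xs} count>0 with P? x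
  ... | yes Px = Any.here Px
  ... | no _   = Any.there (count>0⇒Any count>0)

  count-++ : ∀ xs ys → length (filter P? (xs ++ ys)) ≡ length (filter P? xs) + length (filter P? ys)
  count-++ xs ys = trans (cong length (filter-++ P? xs ys)) (length-++ (filter P? xs))

2∣⇒parity≡0ℙ : ∀ {m} → 2 ∣ m → parity m ≡ 0ℙ
2∣⇒parity≡0ℙ (divides q refl) = trans (ℙ.*-homo-* q 2) (ℙ.*-zeroʳ (parity q))

parity≡0ℙ⇒2∣ : ∀ m → parity m ≡ 0ℙ → 2 ∣ m
parity≡0ℙ⇒2∣ zero          _ = divides 0 refl
parity≡0ℙ⇒2∣ (suc (suc m)) e with parity≡0ℙ⇒2∣ m e
... | divides q refl = divides (suc q) refl

parity≡1ℙ⇒>0 : ∀ {m} → parity m ≡ 1ℙ → 0 < m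
parity≡1ℙ⇒>0 {suc _} _ = s≤s z≤n

+≡0ℙ⇒≡ : ∀ (p q : Parity) → p ℙ.+ q ≡ 0ℙ → p ≡ q
+≡0ℙ⇒≡ 0ℙ 0ℙ _ = refl
+≡0ℙ⇒≡ 1ℙ 1ℙ _ = refl

𝟙 : ∀ {a} {A : Set a} → Dec A → ℕ
𝟙 A? = if does A? then 1 else 0

𝟙-cong : ∀ {a b} {A : Set a} {B : Set b} (A? : Dec A) (B? : Dec B) → (A → B) → (B → A) → 𝟙 A? ≡ 𝟙 B?
𝟙-cong (yes _) (yes _) _   _   = refl
𝟙-cong (no _)  (no _)  _   _   = refl
𝟙-cong (yes a) (no ¬b) A⇒B _   = ⊥-elim (¬b (A⇒B a))
𝟙-cong (no ¬a) (yes b) _   B⇒A = ⊥-elim (¬a (B⇒A b))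

x∈p─q⇒x∉q : x ∈ p ─ q → x ∉ q
x∈p─q⇒x∉q {p = _ ∷ _} {inside ∷ _} () here
x∈p─q⇒x∉q {p = _ ∷ _} {_ ∷ _} (there x∈p─q) (there x∈q) = x∈p─q⇒x∉q x∈p─q x∈q

x∈p-y⇒x∈p : x ∈ p - y → x ∈ p
x∈p-y⇒x∈p {p = p} {y = y} = p─q⊆p p ⁅ y ⁆

x∈p-y⇒x≢y : x ∈ p - y → x ≢ y
x∈p-y⇒x≢y {x = x} x∈p-y refl = x∈p─q⇒x∉q x∈p-y (x∈⁅x⁆ x)

x∉p-x : x ∉ p - x
x∉p-x x∈p-x = x∈p-y⇒x≢y x∈p-x refl

x∈∁p∩q⁺ : x ∉ p → x ∈ q → x ∈ ∁ p ∩ q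
x∈∁p∩q⁺ x∉p x∈q = x∈p∩q⁺ (x∉p⇒x∈∁p x∉p , x∈q)

x∈∁p∩q⁻ : x ∈ ∁ p ∩ q → x ∉ p × x ∈ q
x∈∁p∩q⁻ {p = p} {q = q} x∈∁p∩q with x∈p∩q⁻ (∁ p) q x∈∁p∩q
... | x∈∁p , x∈q = x∈∁p⇒x∉p x∈∁p , x∈q

x∈p⇒∣p∣≡1+∣p-x∣ : x ∈ p → ∣ p ∣ ≡ suc ∣ p - x ∣
x∈p⇒∣p∣≡1+∣p-x∣ {p = inside ∷ p}  here        = cong (suc ∘ ∣_∣) (sym (p─⊥≡p p))
x∈p⇒∣p∣≡1+∣p-x∣ {p = inside ∷ _}  (there x∈p) = cong suc (x∈p⇒∣p∣≡1+∣p-x∣ x∈p)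
x∈p⇒∣p∣≡1+∣p-x∣ {p = outside ∷ _} (there x∈p) = x∈p⇒∣p∣≡1+∣p-x∣ x∈p

x∈p∧y∈p⇒∣p∣≡2+∣p-x-y∣ : x ∈ p → y ∈ p → x ≢ y → ∣ p ∣ ≡ 2 + ∣ p - x - y ∣
x∈p∧y∈p⇒∣p∣≡2+∣p-x-y∣ x∈p y∈p x≢y =
  trans (x∈p⇒∣p∣≡1+∣p-x∣ x∈p) (cong suc (x∈p⇒∣p∣≡1+∣p-x∣ (x∈p∧x≢y⇒x∈p-y y∈p (x≢y ∘ sym))))

x∉p⇒∣p∪⁅x⁆∣≡1+∣p∣ : x ∉ p → ∣ p ∪ ⁅ x ⁆ ∣ ≡ suc ∣ p ∣
x∉p⇒∣p∪⁅x⁆∣≡1+∣p∣ {x = zero}  {inside ∷ _}  x∉p = ⊥-elim (x∉p here)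
x∉p⇒∣p∪⁅x⁆∣≡1+∣p∣ {x = zero}  {outside ∷ p} _   = cong (suc ∘ ∣_∣) (∪-identityʳ p)
x∉p⇒∣p∪⁅x⁆∣≡1+∣p∣ {x = suc _} {inside ∷ _}  x∉p = cong suc (x∉p⇒∣p∪⁅x⁆∣≡1+∣p∣ (x∉p ∘ there))
x∉p⇒∣p∪⁅x⁆∣≡1+∣p∣ {x = suc _} {outside ∷ _} x∉p = x∉p⇒∣p∪⁅x⁆∣≡1+∣p∣ (x∉p ∘ there)

x∈p⇒p-x∪⁅x⁆≡p : x ∈ p → (p - x) ∪ ⁅ x ⁆ ≡ p
x∈p⇒p-x∪⁅x⁆≡p {x = x} {p = p} x∈p = ⊆-antisym ⊆p p⊆
  where
  ⊆p : (p - x) ∪ ⁅ x ⁆ ⊆ p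
  ⊆p y∈ with x∈p∪q⁻ (p - x) ⁅ x ⁆ y∈
  ... | inj₁ y∈p-x = x∈p-y⇒x∈p y∈p-x
  ... | inj₂ y∈⁅x⁆ rewrite x∈⁅y⁆⇒x≡y x y∈⁅x⁆ = x∈p
  p⊆ : p ⊆ (p - x) ∪ ⁅ x ⁆
  p⊆ {y} y∈p with y Fin.≟ x
  ... | yes refl = x∈p∪q⁺ (inj₂ (x∈⁅x⁆ x))
  ... | no y≢x   = x∈p∪q⁺ (inj₁ (x∈p∧x≢y⇒x∈p-y y∈p y≢x))

⊈⇒∃∉ : ∀ {n} {p q : Subset n} → ¬ p ⊆ q → ∃ λ x → x ∈ p × x ∉ q
⊈⇒∃∉ {n} {p} {q} p⊈q
  with x , ¬[x∈p⇒x∈q] ← Fin.¬∀⟶∃¬ n _ (λ x → x ∈? p →-dec x ∈? q) (λ p⊆q → p⊈q (p⊆q _))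
  = x , decidable-stable (x ∈? p) (λ x∉p → ¬[x∈p⇒x∈q] (⊥-elim ∘ x∉p)) , λ x∈q → ¬[x∈p⇒x∈q] (λ _ → x∈q)

⊆⇒≡⊎∣∣< : p ⊆ q → p ≡ q ⊎ ∣ p ∣ < ∣ q ∣
⊆⇒≡⊎∣∣< {p = p} {q = q} p⊆q with q ⊆? p
... | yes q⊆p = inj₁ (⊆-antisym p⊆q q⊆p)
... | no q⊈p with x , x∈q , x∉p ← ⊈⇒∃∉ q⊈p = inj₂ (p⊂q⇒∣p∣<∣q∣ (p⊆q , x , x∈q , x∉p))

⊆∧∣q∣≤∣p∣⇒≡ : p ⊆ q → ∣ q ∣ ≤ ∣ p ∣ → p ≡ q
⊆∧∣q∣≤∣p∣⇒≡ p⊆q ∣q∣≤∣p∣ with ⊆⇒≡⊎∣∣< p⊆q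
... | inj₁ p≡q       = p≡q
... | inj₂ ∣p∣<∣q∣ = ⊥-elim (<⇒≱ ∣p∣<∣q∣ ∣q∣≤∣p∣)

∣p∣>0⇒Nonempty : ∀ {n} {p : Subset n} → 0 < ∣ p ∣ → Nonempty p
∣p∣>0⇒Nonempty {n} {p} ∣p∣>0 with nonempty? p
... | yes p≢∅ = p≢∅
... | no p≡∅  = ⊥-elim (<⇒≢ ∣p∣>0 (sym (trans (cong ∣_∣ (Empty-unique p≡∅)) (∣⊥∣≡0 n))))

⊆∧∣q∣≡1+∣p∣⇒p≡q-x : p ⊆ q → ∣ q ∣ ≡ suc ∣ p ∣ → ∃ λ x → x ∈ q × p ≡ q - x
⊆∧∣q∣≡1+∣p∣⇒p≡q-x {p = p} {q = q} p⊆q ∣q∣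
  with x , x∈q , x∉p ← ⊈⇒∃∉ {p = q} {q = p} (λ q⊆p → 1+n≰n (subst (_≤ ∣ p ∣) ∣q∣ (p⊆q⇒∣p∣≤∣q∣ q⊆p)))
  = x , x∈q , ⊆∧∣q∣≤∣p∣⇒≡ p⊆q-x (≤-reflexive (suc-injective (trans (sym (x∈p⇒∣p∣≡1+∣p-x∣ x∈q)) ∣q∣)))
  where
  p⊆q-x : p ⊆ q - x
  p⊆q-x y∈p = x∈p∧x≢y⇒x∈p-y (p⊆q y∈p) λ { refl → x∉p y∈p }

third-element : 3 ≤ ∣ p ∣ → x ∈ p → y ∈ p → x ≢ y → ∃ λ z → z ∈ p × z ≢ x × z ≢ y
third-element {p = p} {x = x} {y = y} 3≤∣p∣ x∈p y∈p x≢y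
  with z , z∈p-x-y ← ∣p∣>0⇒Nonempty {p = p - x - y}
         (s≤s⁻¹ (s≤s⁻¹ (subst (3 ≤_) (x∈p∧y∈p⇒∣p∣≡2+∣p-x-y∣ x∈p y∈p x≢y) 3≤∣p∣)))
  = z , x∈p-y⇒x∈p {p = p} (x∈p-y⇒x∈p z∈p-x-y) , x∈p-y⇒x≢y {p = p} (x∈p-y⇒x∈p z∈p-x-y) , x∈p-y⇒x≢y z∈p-x-y

module _ {ℓ} {P : Pred (Fin n) ℓ} where

  ⟦_⟧ : Decidable P → Subset n
  ⟦ P? ⟧ = tabulate (does ∘ P?)

  x∈⟦P?⟧⁺ : ∀ (P? : Decidable P) {x} → P x → x ∈ ⟦ P? ⟧
  x∈⟦P?⟧⁺ P? {x} Px = lookup⇒[]= x ⟦ P? ⟧ (trans (lookup∘tabulate (does ∘ P?) x) (dec-true (P? x) Px))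

  x∈⟦P?⟧⁻ : ∀ (P? : Decidable P) {x} → x ∈ ⟦ P? ⟧ → P x
  x∈⟦P?⟧⁻ P? {x} x∈⟦P?⟧ = does⇒P (P? x) (trans (sym (lookup∘tabulate (does ∘ P?) x)) ([]=⇒lookup x∈⟦P?⟧))
    where
    does⇒P : ∀ (P?x : Dec (P x)) → does P?x ≡ true → P x
    does⇒P (yes Px) _ = Px

∑ : Subset n → (Fin n → ℕ) → ℕ
∑ []            f = 0
∑ (inside ∷ p)  f = f zero + ∑ p (f ∘ suc)
∑ (outside ∷ p) f = ∑ p (f ∘ suc)

syntax ∑ p (λ y → e) = ∑[ y ∈ p ] e

∑-cong : ∀ {f g} → (∀ {y} → y ∈ p → f y ≡ g y) → ∑ p f ≡ ∑ p g
∑-cong {p = []}          _   = refl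
∑-cong {p = inside ∷ _}  f≗g = cong₂ _+_ (f≗g here) (∑-cong (f≗g ∘ there))
∑-cong {p = outside ∷ _} f≗g = ∑-cong (f≗g ∘ there)

∑-≡0 : ∀ {f} → (∀ {y} → y ∈ p → f y ≡ 0) → ∑ p f ≡ 0
∑-≡0 {p = []}          _   = refl
∑-≡0 {p = inside ∷ _}  f≡0 = cong₂ _+_ (f≡0 here) (∑-≡0 (f≡0 ∘ there))
∑-≡0 {p = outside ∷ _} f≡0 = ∑-≡0 (f≡0 ∘ there)

∑-distrib-+ : ∀ (p : Subset n) f g → ∑[ y ∈ p ] (f y + g y) ≡ ∑ p f + ∑ p g
∑-distrib-+ []            f g = refl
∑-distrib-+ (inside ∷ p)  f g =
  trans (cong (f zero + g zero +_) (∑-distrib-+ p (f ∘ suc) (g ∘ suc))) (interchange (f zero) (g zero) _ _)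
∑-distrib-+ (outside ∷ p) f g = ∑-distrib-+ p (f ∘ suc) (g ∘ suc)

∑-split : ∀ (p q : Subset n) f → ∑ p f ≡ ∑ (p ∩ q) f + ∑ (p ─ q) f
∑-split []            []            f = refl
∑-split (inside ∷ p)  (inside ∷ q)  f =
  trans (cong (f zero +_) (∑-split p q (f ∘ suc))) (sym (+-assoc (f zero) (∑ (p ∩ q) (f ∘ suc)) _))
∑-split (inside ∷ p)  (outside ∷ q) f =
  trans (cong (f zero +_) (∑-split p q (f ∘ suc))) (x∙yz≈y∙xz (f zero) (∑ (p ∩ q) (f ∘ suc)) _)
∑-split (outside ∷ p) (inside ∷ q)  f = ∑-split p q (f ∘ suc)
∑-split (outside ∷ p) (outside ∷ q) f = ∑-split p q (f ∘ suc)

∑-remove : ∀ {f} → x ∈ p → ∑ p f ≡ f x + ∑ (p - x) f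
∑-remove {p = inside ∷ p} {f} here = cong (λ r → f zero + ∑ r (f ∘ suc)) (sym (p─⊥≡p p))
∑-remove {x = suc x} {p = inside ∷ p} {f} (there x∈p) =
  trans (cong (f zero +_) (∑-remove x∈p)) (x∙yz≈y∙xz (f zero) (f (suc x)) (∑ (p - x) (f ∘ suc)))
∑-remove {p = outside ∷ _} (there x∈p) = ∑-remove x∈p

∑-singleton : ∀ {f} → x ∈ p → (∀ {y} → y ∈ p → y ≡ x) → ∑ p f ≡ f x
∑-singleton {x = x} {p = p} {f} x∈p only-x = begin
  ∑ p f             ≡⟨ ∑-remove x∈p ⟩
  f x + ∑ (p - x) f ≡⟨ cong (f x +_) (∑-≡0 {p = p - x} (⊥-elim ∘ p-x-empty)) ⟩
  f x + 0           ≡⟨ +-identityʳ (f x) ⟩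
  f x               ∎
  where
  open ≡-Reasoning
  p-x-empty : ∀ {y} → y ∉ p - x
  p-x-empty y∈p-x = x∈p-y⇒x≢y y∈p-x (only-x (x∈p-y⇒x∈p y∈p-x))

∑-pair : ∀ {f} → x ≢ y → x ∈ p → y ∈ p → (∀ {z} → z ∈ p → z ≡ x ⊎ z ≡ y) → ∑ p f ≡ f x + f y
∑-pair {x = x} {y = y} {p = p} {f} x≢y x∈p y∈p only-x-y =
  trans (∑-remove x∈p) (cong (f x +_) (∑-singleton (x∈p∧x≢y⇒x∈p-y y∈p (x≢y ∘ sym)) only-y))
  where
  only-y : ∀ {z} → z ∈ p - x → z ≡ y
  only-y z∈p-x with only-x-y (x∈p-y⇒x∈p z∈p-x)
  ... | inj₁ z≡x = ⊥-elim (x∈p-y⇒x≢y z∈p-x z≡x)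
  ... | inj₂ z≡y = z≡y

∑-even : ∀ {f} → (∀ {y} → y ∈ p → parity (f y) ≡ 0ℙ) → parity (∑ p f) ≡ 0ℙ
∑-even {p = []}          _    = refl
∑-even {p = inside ∷ p}  {f} even = begin
  parity (f zero + ∑ p (f ∘ suc))            ≡⟨ ℙ.+-homo-+ (f zero) _ ⟩
  parity (f zero) ℙ.+ parity (∑ p (f ∘ suc)) ≡⟨ cong₂ ℙ._+_ (even here) (∑-even (even ∘ there)) ⟩
  0ℙ                                         ∎
  where open ≡-Reasoning
∑-even {p = outside ∷ _} even = ∑-even (even ∘ there)

p⊆q⇒∣p∣+∑∁p∈q≡∣q∣ : p ⊆ q → ∣ p ∣ + ∑[ y ∈ ∁ p ] 𝟙 (y ∈? q) ≡ ∣ q ∣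
p⊆q⇒∣p∣+∑∁p∈q≡∣q∣ {p = []}          {[]}          _   = refl
p⊆q⇒∣p∣+∑∁p∈q≡∣q∣ {p = inside ∷ _}  {inside ∷ _}  p⊆q = cong suc (p⊆q⇒∣p∣+∑∁p∈q≡∣q∣ (drop-∷-⊆ p⊆q))
p⊆q⇒∣p∣+∑∁p∈q≡∣q∣ {p = inside ∷ _}  {outside ∷ _} p⊆q with () ← p⊆q here
p⊆q⇒∣p∣+∑∁p∈q≡∣q∣ {p = outside ∷ p} {inside ∷ _}  p⊆q =
  trans (+-suc ∣ p ∣ _) (cong suc (p⊆q⇒∣p∣+∑∁p∈q≡∣q∣ (drop-∷-⊆ p⊆q)))
p⊆q⇒∣p∣+∑∁p∈q≡∣q∣ {p = outside ∷ _} {outside ∷ _} p⊆q = p⊆q⇒∣p∣+∑∁p∈q≡∣q∣ (drop-∷-⊆ p⊆q)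

-- Multisets of simplices and their boundaries modulo 2

cover-∷ : ∀ (τ σ : Subset n) T → cover τ (σ ∷ T) ≡ 𝟙 (τ ⊆? σ) + cover τ T
cover-∷ τ σ T with τ ⊆? σ
... | yes _ = refl
... | no _  = refl

cover-++ : ∀ (τ : Subset n) T U → cover τ (T ++ U) ≡ cover τ T + cover τ U
cover-++ τ = count-++ (τ ⊆?_)

mult-++ : ∀ (σ : Subset n) T U → mult σ (T ++ U) ≡ mult σ T + mult σ U
mult-++ σ = count-++ (σ ≟S_)

mult-∷-≡ : ∀ (X : Subset n) T → mult X (X ∷ T) ≡ suc (mult X T)
mult-∷-≡ X T with X ≟S X
... | yes _   = refl
... | no X≢X = ⊥-elim (X≢X refl)

mult-∷-≢ : ∀ {σ X : Subset n} T → σ ≢ X → mult σ (X ∷ T) ≡ mult σ T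
mult-∷-≢ {σ = σ} {X} T σ≢X with σ ≟S X
... | yes σ≡X = ⊥-elim (σ≢X σ≡X)
... | no _    = refl

∈⇒mult>0 : ∀ {σ : Subset n} {T} → σ ∈ₗ T → 0 < mult σ T
∈⇒mult>0 {σ = σ} = filter-some (σ ≟S_)

mult>0⇒∈ : ∀ {σ : Subset n} {T} → 0 < mult σ T → σ ∈ₗ T
mult>0⇒∈ {σ = σ} = count>0⇒Any (σ ≟S_)

mult>0⇒NonEmpty : ∀ {σ : Subset n} {T} → 0 < mult σ T → NonEmpty T
mult>0⇒NonEmpty {T = []} () refl

module _ {ℓ} {P : Pred (Subset n) ℓ} (P? : Decidable P) where

  mult-filter-accept : ∀ {σ} T → P σ → mult σ (filter P? T) ≡ mult σ T
  mult-filter-accept T Pσ = count-filter-⊆ (_ ≟S_) P? (All.universal (λ { _ refl → Pσ }) T)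

  mult-filter-reject : ∀ {σ} T → ¬ P σ → mult σ (filter P? T) ≡ 0
  mult-filter-reject T ¬Pσ = count-filter-disjoint (_ ≟S_) P? (All.universal (λ { _ refl → ¬Pσ }) T)

Disjoint : List (Subset n) → List (Subset n) → Set
Disjoint A B = ∀ σ → mult σ A ≡ 0 ⊎ mult σ B ≡ 0

without : Subset n → List (Subset n) → List (Subset n)
without X = filter (∁? (X ≟S_))

mult-without-≡ : ∀ (X : Subset n) T → mult X (without X T) ≡ 0
mult-without-≡ X T = mult-filter-reject (∁? (X ≟S_)) T (λ X≢X → X≢X refl)

mult-without-≢ : ∀ {σ X : Subset n} T → σ ≢ X → mult σ (without X T) ≡ mult σ T
mult-without-≢ T σ≢X = mult-filter-accept (∁? (_ ≟S_)) T (σ≢X ∘ sym)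

filter-≟-replicate : ∀ (X : Subset n) T → filter (X ≟S_) T ≡ replicate (mult X T) X
filter-≟-replicate X []      = refl
filter-≟-replicate X (σ ∷ T) with X ≟S σ
... | yes refl = cong (X ∷_) (filter-≟-replicate X T)
... | no _     = filter-≟-replicate X T

x∈V⇒∃ : ∀ {x : Fin n} T → x ∈ V T → ∃ λ σ → σ ∈ₗ T × x ∈ σ
x∈V⇒∃ []      x∈⊥ = ⊥-elim (∉⊥ x∈⊥)
x∈V⇒∃ (σ ∷ T) x∈V with x∈p∪q⁻ σ (V T) x∈V
... | inj₁ x∈σ  = σ , Any.here refl , x∈σ
... | inj₂ x∈Vᵀ with τ , τ∈T , x∈τ ← x∈V⇒∃ T x∈Vᵀ = τ , Any.there τ∈T , x∈τ

∈⇒⊆V : ∀ {σ : Subset n} {T} → σ ∈ₗ T → σ ⊆ V T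
∈⇒⊆V {T = τ ∷ T} (Any.here refl)  = p⊆p∪q (V T)
∈⇒⊆V {T = τ ∷ T} (Any.there σ∈T) = q⊆p∪q τ (V T) ∘ ∈⇒⊆V σ∈T

boundary : Subset n → List (Subset n) → Parity
boundary τ T = parity (cover τ T)

boundary-++ : ∀ (τ : Subset n) T U → boundary τ (T ++ U) ≡ boundary τ T ℙ.+ boundary τ U
boundary-++ τ T U = trans (cong parity (cover-++ τ T U)) (ℙ.+-homo-+ (cover τ T) _)

boundary-simplex-⊆ : ∀ {τ X : Subset n} → τ ⊆ X → boundary τ (X ∷ []) ≡ 1ℙ
boundary-simplex-⊆ {τ = τ} {X} τ⊆X with τ ⊆? X
... | yes _   = refl
... | no τ⊈X = ⊥-elim (τ⊈X τ⊆X)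

cycle⇒boundary≡0ℙ : ∀ {k T} {τ : Subset n} → IsCycle k T → ∣ τ ∣ ≡ k → boundary τ T ≡ 0ℙ
cycle⇒boundary≡0ℙ (_ , even) ∣τ∣ = 2∣⇒parity≡0ℙ (even _ ∣τ∣)

boundary≡0ℙ⇒cycle : ∀ {k} {T : List (Subset n)} → IsMulticomplex k T →
  (∀ τ → ∣ τ ∣ ≡ k → boundary τ T ≡ 0ℙ) → IsCycle k T
boundary≡0ℙ⇒cycle T-mc ∂T≡0 = T-mc , λ τ ∣τ∣ → parity≡0ℙ⇒2∣ _ (∂T≡0 τ ∣τ∣)

cycle-∷⇒boundary≡ : ∀ {k} {X τ : Subset n} {T} → IsCycle k (X ∷ T) → ∣ τ ∣ ≡ k →
  boundary τ T ≡ boundary τ (X ∷ [])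
cycle-∷⇒boundary≡ {X = X} {τ} {T} X∷T-cycle ∣τ∣ = sym (+≡0ℙ⇒≡ (boundary τ (X ∷ [])) (boundary τ T)
  (trans (sym (boundary-++ τ (X ∷ []) T)) (cycle⇒boundary≡0ℙ {τ = τ} X∷T-cycle ∣τ∣)))

boundary≡⇒cycle-∷ : ∀ {k} {X : Subset n} {T} → ∣ X ∣ ≡ suc k → IsMulticomplex k T →
  (∀ τ → ∣ τ ∣ ≡ k → boundary τ T ≡ boundary τ (X ∷ [])) → IsCycle k (X ∷ T)
boundary≡⇒cycle-∷ {X = X} {T} ∣X∣ T-mc ∂T≡∂X = boundary≡0ℙ⇒cycle (∣X∣ ∷ T-mc) λ τ ∣τ∣ →
  trans (boundary-++ τ (X ∷ []) T)
        (trans (cong (boundary τ (X ∷ []) ℙ.+_) (∂T≡∂X τ ∣τ∣)) (ℙ.p+p≡0ℙ (boundary τ (X ∷ []))))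

boundary-without : ∀ (τ X : Subset n) T → mult X T ≡ 1 →
  boundary τ T ≡ boundary τ (X ∷ []) ℙ.+ boundary τ (without X T)
boundary-without τ X T X∈T = begin
  parity (cover τ T)
    ≡⟨ cong parity (count-filter-split (τ ⊆?_) (X ≟S_) T) ⟩
  parity (cover τ (filter (X ≟S_) T) + cover τ (without X T))
    ≡⟨ cong (λ U → parity (cover τ U + cover τ (without X T))) X-part ⟩
  parity (cover τ (X ∷ []) + cover τ (without X T))
    ≡⟨ ℙ.+-homo-+ (cover τ (X ∷ [])) _ ⟩
  boundary τ (X ∷ []) ℙ.+ boundary τ (without X T) ∎
  where
  open ≡-Reasoning
  X-part : filter (X ≟S_) T ≡ X ∷ []
  X-part = trans (filter-≟-replicate X T) (cong (λ m → replicate m X) X∈T)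

-- Double counting around a (k−1)-set

link-count-simplex : ∀ j (ρ σ : Subset n) → ∣ σ ∣ ≡ 2 + j → ∣ ρ ∣ ≡ j →
  ∑[ y ∈ ∁ ρ ] 𝟙 (ρ ∪ ⁅ y ⁆ ⊆? σ) ≡ 2 * 𝟙 (ρ ⊆? σ)
link-count-simplex j ρ σ ∣σ∣ ∣ρ∣ with ρ ⊆? σ
... | no ρ⊈σ = ∑-≡0 {p = ∁ ρ} λ {y} _ →
  𝟙-cong (ρ ∪ ⁅ y ⁆ ⊆? σ) (no ρ⊈σ) (λ ρ∪y⊆σ → ρ∪y⊆σ ∘ p⊆p∪q ⁅ y ⁆) (⊥-elim ∘ ρ⊈σ)
... | yes ρ⊆σ = +-cancelˡ-≡ j _ _ (begin
  j + ∑[ y ∈ ∁ ρ ] 𝟙 (ρ ∪ ⁅ y ⁆ ⊆? σ)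
    ≡⟨ cong₂ _+_ (sym ∣ρ∣) (∑-cong {p = ∁ ρ} λ {y} _ →
         𝟙-cong (ρ ∪ ⁅ y ⁆ ⊆? σ) (y ∈? σ) (_$ x∈p∪q⁺ (inj₂ (x∈⁅x⁆ y))) (ρ∪⁅y⁆⊆σ y)) ⟩
  ∣ ρ ∣ + ∑[ y ∈ ∁ ρ ] 𝟙 (y ∈? σ)
    ≡⟨ p⊆q⇒∣p∣+∑∁p∈q≡∣q∣ ρ⊆σ ⟩
  ∣ σ ∣
    ≡⟨ trans ∣σ∣ (+-comm 2 j) ⟩
  j + 2 ∎)
  where
  open ≡-Reasoning
  ρ∪⁅y⁆⊆σ : ∀ y → y ∈ σ → ρ ∪ ⁅ y ⁆ ⊆ σ
  ρ∪⁅y⁆⊆σ y y∈σ z∈ρ∪y with x∈p∪q⁻ ρ ⁅ y ⁆ z∈ρ∪y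
  ... | inj₁ z∈ρ = ρ⊆σ z∈ρ
  ... | inj₂ z∈⁅y⁆ rewrite x∈⁅y⁆⇒x≡y y z∈⁅y⁆ = y∈σ

-- Each member σ ⊇ ρ is counted once for each of the two vertices of σ ─ ρ.
link-count : ∀ j (ρ : Subset n) T → All (λ σ → ∣ σ ∣ ≡ 2 + j) T → ∣ ρ ∣ ≡ j →
  ∑[ y ∈ ∁ ρ ] cover (ρ ∪ ⁅ y ⁆) T ≡ 2 * cover ρ T
link-count j ρ [] _ _ = ∑-≡0 {p = ∁ ρ} λ _ → refl
link-count j ρ (σ ∷ T) (∣σ∣ ∷ ∣T∣) ∣ρ∣ = begin
  ∑[ y ∈ ∁ ρ ] cover (ρ ∪ ⁅ y ⁆) (σ ∷ T)
    ≡⟨ ∑-cong {p = ∁ ρ} (λ {y} _ → cover-∷ (ρ ∪ ⁅ y ⁆) σ T) ⟩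
  ∑[ y ∈ ∁ ρ ] (𝟙 (ρ ∪ ⁅ y ⁆ ⊆? σ) + cover (ρ ∪ ⁅ y ⁆) T)
    ≡⟨ ∑-distrib-+ (∁ ρ) _ _ ⟩
  ∑[ y ∈ ∁ ρ ] 𝟙 (ρ ∪ ⁅ y ⁆ ⊆? σ) + ∑[ y ∈ ∁ ρ ] cover (ρ ∪ ⁅ y ⁆) T
    ≡⟨ cong₂ _+_ (link-count-simplex j ρ σ ∣σ∣ ∣ρ∣) (link-count j ρ T ∣T∣ ∣ρ∣) ⟩
  2 * 𝟙 (ρ ⊆? σ) + 2 * cover ρ T
    ≡⟨ sym (*-distribˡ-+ 2 (𝟙 (ρ ⊆? σ)) _) ⟩
  2 * (𝟙 (ρ ⊆? σ) + cover ρ T)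
    ≡⟨ cong (2 *_) (sym (cover-∷ ρ σ T)) ⟩
  2 * cover ρ (σ ∷ T) ∎
  where open ≡-Reasoning

BoundaryWithin : ℕ → List (Subset n) → Subset n → Set
BoundaryWithin k T X = ∀ τ {y} → ∣ τ ∣ ≡ k → y ∈ τ → y ∉ X → boundary τ T ≡ 0ℙ

module _ {j} {T : List (Subset n)} {X : Subset n}
         (T-mc : IsMulticomplex (suc j) T) (∂T⊆X : BoundaryWithin (suc j) T X) where

  link-boundary : ∀ ρ → ∣ ρ ∣ ≡ j → parity (∑[ y ∈ ∁ ρ ∩ X ] cover (ρ ∪ ⁅ y ⁆) T) ≡ 0ℙ
  link-boundary ρ ∣ρ∣ = begin
    parity (∑ (∁ ρ ∩ X) f)                            ≡⟨ sym (ℙ.+-identityʳ (parity (∑ (∁ ρ ∩ X) f))) ⟩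
    parity (∑ (∁ ρ ∩ X) f) ℙ.+ 0ℙ                     ≡⟨ cong (parity (∑ (∁ ρ ∩ X) f) ℙ.+_) (sym outside-X-even) ⟩
    parity (∑ (∁ ρ ∩ X) f) ℙ.+ parity (∑ (∁ ρ ─ X) f) ≡⟨ sym (ℙ.+-homo-+ (∑ (∁ ρ ∩ X) f) _) ⟩
    parity (∑ (∁ ρ ∩ X) f + ∑ (∁ ρ ─ X) f)            ≡⟨ cong parity (sym (∑-split (∁ ρ) X f)) ⟩
    parity (∑ (∁ ρ) f)                                ≡⟨ cong parity (link-count j ρ T T-mc ∣ρ∣) ⟩
    parity (2 * cover ρ T)                            ≡⟨ 2∣⇒parity≡0ℙ (divides (cover ρ T) (*-comm 2 (cover ρ T))) ⟩
    0ℙ                                                ∎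
    where
    open ≡-Reasoning
    f : Fin n → ℕ
    f y = cover (ρ ∪ ⁅ y ⁆) T
    outside-X-even : parity (∑ (∁ ρ ─ X) f) ≡ 0ℙ
    outside-X-even = ∑-even {p = ∁ ρ ─ X} λ {y} y∈ →
      ∂T⊆X (ρ ∪ ⁅ y ⁆) (trans (x∉p⇒∣p∪⁅x⁆∣≡1+∣p∣ (x∈∁p⇒x∉p (p─q⊆p (∁ ρ) X y∈))) (cong suc ∣ρ∣))
        (x∈p∪q⁺ (inj₂ (x∈⁅x⁆ y))) (x∈p─q⇒x∉q y∈)

  boundaryWithin-X : ∣ X ∣ ≡ suc j → boundary X T ≡ 0ℙ
  boundaryWithin-X ∣X∣ with a , a∈X ← ∣p∣>0⇒Nonempty (subst (0 <_) (sym ∣X∣) (s≤s z≤n)) = begin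
    parity (cover X T)
      ≡⟨ cong (λ σ → parity (cover σ T)) (sym (x∈p⇒p-x∪⁅x⁆≡p a∈X)) ⟩
    parity (cover ((X - a) ∪ ⁅ a ⁆) T)
      ≡⟨ cong parity (sym (∑-singleton (x∈∁p∩q⁺ x∉p-x a∈X) only-a)) ⟩
    parity (∑[ y ∈ ∁ (X - a) ∩ X ] cover ((X - a) ∪ ⁅ y ⁆) T)
      ≡⟨ link-boundary (X - a) ∣X-a∣ ⟩
    0ℙ ∎
    where
    open ≡-Reasoning
    ∣X-a∣ : ∣ X - a ∣ ≡ j
    ∣X-a∣ = suc-injective (trans (sym (x∈p⇒∣p∣≡1+∣p-x∣ a∈X)) ∣X∣)
    only-a : ∀ {y} → y ∈ ∁ (X - a) ∩ X → y ≡ a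
    only-a {y} y∈ with y∉X-a , y∈X ← x∈∁p∩q⁻ y∈ = decidable-stable (y Fin.≟ a) (y∉X-a ∘ x∈p∧x≢y⇒x∈p-y y∈X)

  boundaryWithin⇒cycle : ∣ X ∣ ≤ suc j → IsCycle (suc j) T
  boundaryWithin⇒cycle ∣X∣≤1+j = boundary≡0ℙ⇒cycle T-mc ∂T≡0
    where
    ∂T≡0 : ∀ τ → ∣ τ ∣ ≡ suc j → boundary τ T ≡ 0ℙ
    ∂T≡0 τ ∣τ∣ with τ ⊆? X
    ... | no τ⊈X with y , y∈τ , y∉X ← ⊈⇒∃∉ τ⊈X = ∂T⊆X τ ∣τ∣ y∈τ y∉X
    ... | yes τ⊆X with refl ← ⊆∧∣q∣≤∣p∣⇒≡ τ⊆X (subst (∣ X ∣ ≤_) (sym ∣τ∣) ∣X∣≤1+j) = boundaryWithin-X ∣τ∣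

  boundaryWithin-X-a≡X-b : ∣ X ∣ ≡ 2 + j → ∀ {a b} → a ∈ X → b ∈ X → boundary (X - a) T ≡ boundary (X - b) T
  boundaryWithin-X-a≡X-b ∣X∣ {a} {b} a∈X b∈X with a Fin.≟ b
  ... | yes refl = refl
  ... | no a≢b = sym (+≡0ℙ⇒≡ (boundary (X - b) T) _ (begin
    parity (cover (X - b) T) ℙ.+ parity (cover (X - a) T) ≡⟨ sym (ℙ.+-homo-+ (cover (X - b) T) _) ⟩
    parity (cover (X - b) T + cover (X - a) T)            ≡⟨ cong parity (sym (cong₂ _+_ f-a f-b)) ⟩
    parity (f a + f b)                                    ≡⟨ cong parity (sym (∑-pair a≢b a∈ b∈ a-or-b)) ⟩
    parity (∑ (∁ ρ ∩ X) f)                                ≡⟨ link-boundary ρ ∣ρ∣ ⟩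
    0ℙ                                                    ∎))
    where
    open ≡-Reasoning
    ρ : Subset n
    ρ = X - a - b
    f : Fin n → ℕ
    f y = cover (ρ ∪ ⁅ y ⁆) T
    ∣ρ∣ : ∣ ρ ∣ ≡ j
    ∣ρ∣ = suc-injective (suc-injective (trans (sym (x∈p∧y∈p⇒∣p∣≡2+∣p-x-y∣ a∈X b∈X a≢b)) ∣X∣))
    f-a : f a ≡ cover (X - b) T
    f-a = trans (cong (λ σ → cover (σ ∪ ⁅ a ⁆) T) (p─x─y≡p─y─x X a b))
                (cong (λ σ → cover σ T) (x∈p⇒p-x∪⁅x⁆≡p (x∈p∧x≢y⇒x∈p-y a∈X a≢b)))
    f-b : f b ≡ cover (X - a) T
    f-b = cong (λ σ → cover σ T) (x∈p⇒p-x∪⁅x⁆≡p (x∈p∧x≢y⇒x∈p-y b∈X (a≢b ∘ sym)))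
    a∈ : a ∈ ∁ ρ ∩ X
    a∈ = x∈∁p∩q⁺ (x∉p-x ∘ x∈p-y⇒x∈p) a∈X
    b∈ : b ∈ ∁ ρ ∩ X
    b∈ = x∈∁p∩q⁺ x∉p-x b∈X
    a-or-b : ∀ {y} → y ∈ ∁ ρ ∩ X → y ≡ a ⊎ y ≡ b
    a-or-b {y} y∈ with x∈∁p∩q⁻ y∈ | y Fin.≟ a | y Fin.≟ b
    ... | _         | yes y≡a | _       = inj₁ y≡a
    ... | _         | no _    | yes y≡b = inj₂ y≡b
    ... | y∉ρ , y∈X | no y≢a  | no y≢b  = ⊥-elim (y∉ρ (x∈p∧x≢y⇒x∈p-y (x∈p∧x≢y⇒x∈p-y y∈X y≢a) y≢b))

  boundaryWithin-scaled : ∣ X ∣ ≡ 2 + j → ∀ {a} → a ∈ X →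
    ∀ τ → ∣ τ ∣ ≡ suc j → boundary τ T ≡ boundary (X - a) T ℙ.* boundary τ (X ∷ [])
  boundaryWithin-scaled ∣X∣ a∈X τ ∣τ∣ with τ ⊆? X
  ... | no τ⊈X with y , y∈τ , y∉X ← ⊈⇒∃∉ τ⊈X =
    trans (∂T⊆X τ ∣τ∣ y∈τ y∉X) (sym (ℙ.*-zeroʳ _))
  ... | yes τ⊆X with b , b∈X , refl ← ⊆∧∣q∣≡1+∣p∣⇒p≡q-x τ⊆X (trans ∣X∣ (cong suc (sym ∣τ∣))) =
    trans (boundaryWithin-X-a≡X-b ∣X∣ b∈X a∈X) (sym (ℙ.*-identityʳ _))

  boundaryWithin⇒boundary≡simplex : ∣ X ∣ ≡ 2 + j → ¬ IsCycle (suc j) T →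
    ∀ τ → ∣ τ ∣ ≡ suc j → boundary τ T ≡ boundary τ (X ∷ [])
  boundaryWithin⇒boundary≡simplex ∣X∣ ¬cycle
    with a , a∈X ← ∣p∣>0⇒Nonempty (subst (0 <_) (sym ∣X∣) (s≤s z≤n))
    with boundary (X - a) T in ∂[X-a]
  ... | 0ℙ = ⊥-elim (¬cycle (boundary≡0ℙ⇒cycle T-mc λ τ ∣τ∣ →
               trans (boundaryWithin-scaled ∣X∣ a∈X τ ∣τ∣) (cong (ℙ._* _) ∂[X-a])))
  ... | 1ℙ = λ τ ∣τ∣ → trans (boundaryWithin-scaled ∣X∣ a∈X τ ∣τ∣) (cong (ℙ._* _) ∂[X-a])

-- Connected components of G(S) − X

adj? : ∀ (S : List (Subset n)) u v → Dec (Adj S u v)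
adj? S u v = ¬? (u Fin.≟ v) ×-dec Any.any? (λ σ → u ∈? σ ×-dec v ∈? σ) S

module _ {S : List (Subset n)} {X : Subset n} where

  reach-snoc : ∀ {u v w} → Reach S X u v → Adj S v w → w ∉ X → Reach S X u w
  reach-snoc here               v~w w∉X = step v~w w∉X here
  reach-snoc (step u~u′ u′∉X r) v~w w∉X = step u~u′ u′∉X (reach-snoc r v~w w∉X)

  reach-∉ : ∀ {u w} → u ∉ X → Reach S X u w → w ∉ X
  reach-∉ u∉X here            = u∉X
  reach-∉ _   (step _ u′∉X r) = reach-∉ u′∉X r

module Component (S : List (Subset n)) (X : Subset n) (u : Fin n) where

  Extends : Subset n → Fin n → Set
  Extends R w = w ∉ X × ∃ λ v → v ∈ R × Adj S v w

  extends? : ∀ R → Decidable (Extends R)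
  extends? R w = ¬? (w ∈? X) ×-dec Fin.any? (λ v → v ∈? R ×-dec adj? S v w)

  grow : Subset n → Subset n
  grow R = R ∪ ⟦ extends? R ⟧

  reached : ℕ → Subset n
  reached zero    = ⁅ u ⁆
  reached (suc i) = grow (reached i)

  stable-or-large : ∀ i → grow (reached i) ≡ reached i ⊎ i < ∣ reached i ∣
  stable-or-large zero = inj₂ (subst (0 <_) (sym (∣⁅x⁆∣≡1 u)) (s≤s z≤n))
  stable-or-large (suc i) with stable-or-large i
  ... | inj₁ stable = inj₁ (cong grow stable)
  ... | inj₂ i<∣R∣ with ⊆⇒≡⊎∣∣< (p⊆p∪q {p = reached i} _)
  ...   | inj₁ R≡grow-R     = inj₁ (cong grow (sym R≡grow-R))
  ...   | inj₂ ∣R∣<∣grow-R∣ = inj₂ (≤-trans (s≤s i<∣R∣) ∣R∣<∣grow-R∣)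

  component : Subset n
  component = reached n

  component-stable : grow component ≡ component
  component-stable with stable-or-large n
  ... | inj₁ stable = stable
  ... | inj₂ n<∣C∣  = ⊥-elim (<⇒≱ n<∣C∣ (∣p∣≤n component))

  u∈reached : ∀ i → u ∈ reached i
  u∈reached zero    = x∈⁅x⁆ u
  u∈reached (suc i) = p⊆p∪q _ (u∈reached i)

  reached⇒reach : ∀ i {w} → w ∈ reached i → Reach S X u w
  reached⇒reach zero    w∈⁅u⁆ rewrite x∈⁅y⁆⇒x≡y u w∈⁅u⁆ = here
  reached⇒reach (suc i) w∈ with x∈p∪q⁻ (reached i) _ w∈
  ... | inj₁ w∈R = reached⇒reach i w∈R
  ... | inj₂ w∈new with w∉X , v , v∈R , v~w ← x∈⟦P?⟧⁻ (extends? (reached i)) w∈new =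
    reach-snoc (reached⇒reach i v∈R) v~w w∉X

  u∈component : u ∈ component
  u∈component = u∈reached n

  component⇒reach : ∀ {w} → w ∈ component → Reach S X u w
  component⇒reach = reached⇒reach n

  reach⇒component : ∀ {v w} → Reach S X v w → v ∈ component → w ∈ component
  reach⇒component here                        v∈C = v∈C
  reach⇒component (step {v = v′} v~v′ v′∉X r) v∈C = reach⇒component r
    (subst (v′ ∈_) component-stable (q⊆p∪q component _ (x∈⟦P?⟧⁺ (extends? component) (v′∉X , _ , v∈C , v~v′))))

  reach? : ∀ w → Dec (Reach S X u w)
  reach? w = map′ component⇒reach (λ r → reach⇒component r u∈component) (w ∈? component)

-- Splitting a circuit along a (k+1)-set

module _ {k} {S A B : List (Subset n)} {X : Subset n}
         (S-circuit : IsCircuit k S) (S≡A+B : ∀ σ → mult σ S ≡ mult σ A + mult σ B) (A∩B≡∅ : Disjoint A B)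
         {σ₀ : Subset n} (σ₀∈B : 0 < mult σ₀ B) (σ₀≢X : σ₀ ≢ X) where

  private
    S-minimal : ∀ T → T ⊑ S → NonEmpty T → IsCycle k T → T ≈M S
    S-minimal = proj₂ (proj₂ S-circuit)

    A⊑S : A ⊑ S
    A⊑S σ = subst (mult σ A ≤_) (sym (S≡A+B σ)) (m≤m+n _ _)

    ⊑X∷A⇒≤A : ∀ T {σ} → T ⊑ (X ∷ A) → σ ≢ X → mult σ T ≤ mult σ A
    ⊑X∷A⇒≤A T {σ} T⊑X∷A σ≢X = subst (mult σ T ≤_) (mult-∷-≢ A σ≢X) (T⊑X∷A σ)

  ⊑X∷A⇒≉S : ∀ T → T ⊑ (X ∷ A) → ¬ T ≈M S
  ⊑X∷A⇒≉S T T⊑X∷A T≈S with A∩B≡∅ σ₀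
  ... | inj₂ σ₀∉B = <-irrefl (sym σ₀∉B) σ₀∈B
  ... | inj₁ σ₀∉A = <-irrefl refl (begin-strict
    0                     <⟨ σ₀∈B ⟩
    mult σ₀ B             ≤⟨ m≤n+m _ _ ⟩
    mult σ₀ A + mult σ₀ B ≡⟨ sym (S≡A+B σ₀) ⟩
    mult σ₀ S             ≡⟨ sym (T≈S σ₀) ⟩
    mult σ₀ T             ≤⟨ ⊑X∷A⇒≤A T T⊑X∷A σ₀≢X ⟩
    mult σ₀ A             ≡⟨ σ₀∉A ⟩
    0                     ∎)
    where open ≤-Reasoning

  split-simplex-∉ : mult X A ≡ 0 → IsCycle k (X ∷ A) → mult X S ≡ 0
  split-simplex-∉ X∉A X∷A-cycle with mult X S in X∈S
  ... | zero  = refl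
  ... | suc _ = ⊥-elim (⊑X∷A⇒≉S (X ∷ A) (λ _ → ≤-refl) (S-minimal (X ∷ A) X∷A⊑S (λ ()) X∷A-cycle))
    where
    X∷A⊑S : (X ∷ A) ⊑ S
    X∷A⊑S σ with σ ≟S X
    ... | yes refl rewrite X∉A | X∈S = s≤s z≤n
    ... | no _     = A⊑S σ

  module _ (X∉A : mult X A ≡ 0) (X∉B : mult X B ≡ 0) (X∷B-cycle : IsCycle k (X ∷ B)) where

    subcycle-avoiding-X : ∀ T → T ⊑ (X ∷ A) → NonEmpty T → IsCycle k T → mult X T ≡ 0 → ⊥
    subcycle-avoiding-X T T⊑X∷A T≢[] T-cycle X∉T = ⊑X∷A⇒≉S T T⊑X∷A (S-minimal T T⊑S T≢[] T-cycle)
      where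
      T⊑S : T ⊑ S
      T⊑S σ with σ ≟S X
      ... | yes refl = subst (_≤ mult X S) (sym X∉T) z≤n
      ... | no σ≢X   = ≤-trans (⊑X∷A⇒≤A T T⊑X∷A σ≢X) (A⊑S σ)

    -- Replacing X by B in T gives a nonempty subcycle of S, which is therefore all of S.
    subcycle-through-X : ∀ T → T ⊑ (X ∷ A) → IsCycle k T → mult X T ≡ 1 → T ≈M (X ∷ A)
    subcycle-through-X T T⊑X∷A T-cycle X∈T σ with σ ≟S X
    ... | yes refl = trans X∈T (cong suc (sym X∉A))
    ... | no σ≢X   = +-cancelʳ-≡ _ _ _ (begin
      mult σ T + mult σ B             ≡⟨ cong (_+ mult σ B) (sym (mult-without-≢ T σ≢X)) ⟩
      mult σ (without X T) + mult σ B ≡⟨ sym (mult-++ σ (without X T) B) ⟩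
      mult σ T′                       ≡⟨ T′≈S σ ⟩
      mult σ S                        ≡⟨ S≡A+B σ ⟩
      mult σ A + mult σ B             ∎)
      where
      open ≡-Reasoning
      T′ : List (Subset n)
      T′ = without X T ++ B
      T′⊑S : T′ ⊑ S
      T′⊑S ρ with ρ ≟S X
      ... | yes refl = subst (_≤ mult X S)
                         (sym (trans (mult-++ X (without X T) B) (cong₂ _+_ (mult-without-≡ X T) X∉B))) z≤n
      ... | no ρ≢X   = subst (_≤ mult ρ S)
                         (sym (trans (mult-++ ρ (without X T) B) (cong (_+ mult ρ B) (mult-without-≢ T ρ≢X))))
                         (subst (mult ρ T + mult ρ B ≤_) (sym (S≡A+B ρ)) (+-monoˡ-≤ (mult ρ B) (⊑X∷A⇒≤A T T⊑X∷A ρ≢X)))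
      T′≢[] : NonEmpty T′
      T′≢[] = mult>0⇒NonEmpty (≤-trans σ₀∈B (subst (mult σ₀ B ≤_) (sym (mult-++ σ₀ (without X T) B)) (m≤n+m _ _)))
      ∂[T-X]≡∂X : ∀ τ → ∣ τ ∣ ≡ k → boundary τ (without X T) ≡ boundary τ (X ∷ [])
      ∂[T-X]≡∂X τ ∣τ∣ = sym (+≡0ℙ⇒≡ _ _ (trans (sym (boundary-without τ X T X∈T)) (cycle⇒boundary≡0ℙ T-cycle ∣τ∣)))
      T′-cycle : IsCycle k T′
      T′-cycle = boundary≡0ℙ⇒cycle (++⁺ (filter⁺ _ (proj₁ T-cycle)) (All.tail (proj₁ X∷B-cycle))) λ τ ∣τ∣ → begin
        boundary τ T′
          ≡⟨ boundary-++ τ (without X T) B ⟩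
        boundary τ (without X T) ℙ.+ boundary τ B
          ≡⟨ cong₂ ℙ._+_ (∂[T-X]≡∂X τ ∣τ∣) (cycle-∷⇒boundary≡ X∷B-cycle ∣τ∣) ⟩
        boundary τ (X ∷ []) ℙ.+ boundary τ (X ∷ [])
          ≡⟨ ℙ.p+p≡0ℙ (boundary τ (X ∷ [])) ⟩
        0ℙ ∎
      T′≈S : T′ ≈M S
      T′≈S = S-minimal T′ T′⊑S T′≢[] T′-cycle

    split-side-circuit : IsCycle k (X ∷ A) → IsCircuit k (X ∷ A)
    split-side-circuit X∷A-cycle = (λ ()) , X∷A-cycle , minimal
      where
      minimal : ∀ T → T ⊑ (X ∷ A) → NonEmpty T → IsCycle k T → T ≈M (X ∷ A)
      minimal T T⊑X∷A T≢[] T-cycle with mult X T in X∈T | T⊑X∷A X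
      ... | zero        | _ = ⊥-elim (subcycle-avoiding-X T T⊑X∷A T≢[] T-cycle X∈T)
      ... | suc zero    | _ = subcycle-through-X T T⊑X∷A T-cycle X∈T
      ... | suc (suc _) | X∈T≤ with s≤s () ← subst (suc (suc _) ≤_) (trans (mult-∷-≡ X A) (cong suc X∉A)) X∈T≤

circuit-split : ∀ {k} {S A B : List (Subset n)} {X σ₁ σ₂ : Subset n} → IsCircuit k S →
  (∀ σ → mult σ S ≡ mult σ A + mult σ B) → Disjoint A B → mult X A ≡ 0 →
  0 < mult σ₁ A → σ₁ ≢ X → 0 < mult σ₂ B → σ₂ ≢ X → IsCycle k (X ∷ A) → IsCycle k (X ∷ B) →
  mult X S ≡ 0 × IsCircuit k (X ∷ A) × IsCircuit k (X ∷ B) ×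
  InterIsSingleton (X ∷ A) (X ∷ B) X × IsSymDiff S (X ∷ A) (X ∷ B)
circuit-split {S = S} {A} {B} {X} S-circuit S≡A+B A∩B≡∅ X∉A σ₁∈A σ₁≢X σ₂∈B σ₂≢X X∷A-cycle X∷B-cycle =
  X∉S ,
  split-side-circuit {A = A} {B} {X} S-circuit S≡A+B A∩B≡∅ σ₂∈B σ₂≢X X∉A X∉B X∷B-cycle X∷A-cycle ,
  split-side-circuit {A = B} {A} {X} S-circuit S≡B+A (Sum.swap ∘ A∩B≡∅) σ₁∈A σ₁≢X X∉B X∉A X∷A-cycle X∷B-cycle ,
  intersection , symmetric-difference
  where
  X∉S : mult X S ≡ 0
  X∉S = split-simplex-∉ {A = A} {B} {X} S-circuit S≡A+B A∩B≡∅ σ₂∈B σ₂≢X X∉A X∷A-cycle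
  X∉B : mult X B ≡ 0
  X∉B = m+n≡0⇒n≡0 (mult X A) (trans (sym (S≡A+B X)) X∉S)
  S≡B+A : ∀ σ → mult σ S ≡ mult σ B + mult σ A
  S≡B+A σ = trans (S≡A+B σ) (+-comm (mult σ A) _)
  intersection : InterIsSingleton (X ∷ A) (X ∷ B) X
  intersection σ with σ ≟S X
  ... | yes refl = cong₂ (λ a b → suc a ⊓ suc b) X∉A X∉B
  ... | no _ with A∩B≡∅ σ
  ...   | inj₁ σ∉A rewrite σ∉A = refl
  ...   | inj₂ σ∉B rewrite σ∉B = ⊓-zeroʳ (mult σ A)
  symmetric-difference : IsSymDiff S (X ∷ A) (X ∷ B)
  symmetric-difference σ with σ ≟S X
  ... | yes refl = trans X∉S (cong₂ (λ a b → ∣ suc a -ℕ suc b ∣) (sym X∉A) (sym X∉B))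
  ... | no _ with A∩B≡∅ σ
  ...   | inj₁ σ∉A rewrite S≡A+B σ | σ∉A = refl
  ...   | inj₂ σ∉B rewrite S≡A+B σ | σ∉B = trans (+-identityʳ (mult σ A)) (sym (∣-∣-identityʳ (mult σ A)))

cycle-∷⇒boundary-facet≡1ℙ : ∀ {k} {A : List (Subset n)} {X : Subset n} → ∣ X ∣ ≡ suc k →
  IsCycle k (X ∷ A) → x ∈ X → boundary (X - x) A ≡ 1ℙ
cycle-∷⇒boundary-facet≡1ℙ {x = x} {X = X} ∣X∣ X∷A-cycle x∈X =
  trans (cycle-∷⇒boundary≡ X∷A-cycle (suc-injective (trans (sym (x∈p⇒∣p∣≡1+∣p-x∣ x∈X)) ∣X∣)))
        (boundary-simplex-⊆ (x∈p-y⇒x∈p {p = X} {y = x}))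

cycle-∷⇒clique : ∀ {k} {S A : List (Subset n)} {X : Subset n} → 2 ≤ k → ∣ X ∣ ≡ suc k → A ⊑ S →
  IsCycle k (X ∷ A) → ∀ u v → u ∈ X → v ∈ X → u ≢ v → Adj S u v
cycle-∷⇒clique {S = S} {A} {X} 2≤k ∣X∣ A⊑S X∷A-cycle u v u∈X v∈X u≢v
  with w , w∈X , w≢u , w≢v ← third-element (subst (3 ≤_) (sym ∣X∣) (s≤s 2≤k)) u∈X v∈X u≢v
  with σ , σ∈A , X-w⊆σ ← find (count>0⇒Any (X - w ⊆?_) {A}
                                 (parity≡1ℙ⇒>0 (cycle-∷⇒boundary-facet≡1ℙ {A = A} ∣X∣ X∷A-cycle w∈X)))
  = u≢v , lose (mult>0⇒∈ {T = S} (≤-trans (∈⇒mult>0 σ∈A) (A⊑S σ)))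
                (X-w⊆σ (x∈p∧x≢y⇒x∈p-y u∈X (w≢u ∘ sym)) , X-w⊆σ (x∈p∧x≢y⇒x∈p-y v∈X (w≢v ∘ sym)))

-- A circuit separated by X

module Separated {j} {S : List (Subset n)} (S-circuit : IsCircuit (suc j) S) {X : Subset n} {u v : Fin n}
                 (u∈V : u ∈ V S) (u∉X : u ∉ X) (v∈V : v ∈ V S) (v∉X : v ∉ X) (u↛v : ¬ Reach S X u v) where

  open Component S X u using (component; u∈component; component⇒reach; reach⇒component)

  Meets : Subset n → Set
  Meets σ = Nonempty (σ ∩ component)

  meets? : Decidable Meets
  meets? σ = nonempty? (σ ∩ component)

  A B : List (Subset n)
  A = filter meets? S
  B = filter (∁? meets?) S

  private
    S-cycle : IsCycle (suc j) S
    S-cycle = proj₁ (proj₂ S-circuit)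

    σᵤ σᵥ : Subset n
    σᵤ = proj₁ (x∈V⇒∃ S u∈V)
    σᵥ = proj₁ (x∈V⇒∃ S v∈V)

    σᵤ∈S : σᵤ ∈ₗ S
    σᵤ∈S = proj₁ (proj₂ (x∈V⇒∃ S u∈V))

    σᵥ∈S : σᵥ ∈ₗ S
    σᵥ∈S = proj₁ (proj₂ (x∈V⇒∃ S v∈V))

    u∈σᵤ : u ∈ σᵤ
    u∈σᵤ = proj₂ (proj₂ (x∈V⇒∃ S u∈V))

    v∈σᵥ : v ∈ σᵥ
    v∈σᵥ = proj₂ (proj₂ (x∈V⇒∃ S v∈V))

  component∩X≡∅ : ∀ {w} → w ∈ component → w ∉ X
  component∩X≡∅ = reach-∉ u∉X ∘ component⇒reach

  meets⇒⊆component∪X : ∀ {σ y} → σ ∈ₗ S → Meets σ → y ∈ σ → y ∈ component ⊎ y ∈ X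
  meets⇒⊆component∪X {σ} {y} σ∈S (c , c∈σ∩C) y∈σ with x∈p∩q⁻ σ component c∈σ∩C | y ∈? X | c Fin.≟ y
  ... | _         | yes y∈X | _        = inj₂ y∈X
  ... | _ , c∈C   | no _    | yes refl = inj₁ c∈C
  ... | c∈σ , c∈C | no y∉X  | no c≢y   = inj₁ (reach⇒component (step (c≢y , lose σ∈S (c∈σ , y∈σ)) y∉X here) c∈C)

  boundary-A-within-X : BoundaryWithin (suc j) A X
  boundary-A-within-X τ {y} ∣τ∣ y∈τ y∉X with y ∈? component
  ... | yes y∈C = trans (cong parity (count-filter-⊆ (τ ⊆?_) meets? (All.universal τ⊆⇒meets S)))
                        (cycle⇒boundary≡0ℙ S-cycle ∣τ∣)
    where
    τ⊆⇒meets : ∀ σ → τ ⊆ σ → Meets σ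
    τ⊆⇒meets σ τ⊆σ = y , x∈p∩q⁺ (τ⊆σ y∈τ , y∈C)
  ... | no y∉C  = cong parity (count-filter-disjoint (τ ⊆?_) meets? (All.tabulate λ σ∈S τ⊆σ σ-meets →
                    Sum.[ y∉C , y∉X ] (meets⇒⊆component∪X σ∈S σ-meets (τ⊆σ y∈τ))))

  S≡A+B : ∀ σ → mult σ S ≡ mult σ A + mult σ B
  S≡A+B σ = count-filter-split (σ ≟S_) meets? S

  A∩B≡∅ : Disjoint A B
  A∩B≡∅ σ with meets? σ
  ... | yes σ-meets = inj₂ (mult-filter-reject (∁? meets?) S (λ ¬meets → ¬meets σ-meets))
  ... | no ¬meets   = inj₁ (mult-filter-reject meets? S ¬meets)

  A⊑S : A ⊑ S
  A⊑S σ = subst (mult σ A ≤_) (sym (S≡A+B σ)) (m≤m+n _ _)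

  X∉A : mult X A ≡ 0
  X∉A = mult-filter-reject meets? S λ (c , c∈X∩C) → uncurry (flip component∩X≡∅) (x∈p∩q⁻ X component c∈X∩C)

  σᵤ∈A : 0 < mult σᵤ A
  σᵤ∈A = subst (0 <_) (sym (mult-filter-accept meets? S (u , x∈p∩q⁺ (u∈σᵤ , u∈component)))) (∈⇒mult>0 σᵤ∈S)

  σᵤ≢X : σᵤ ≢ X
  σᵤ≢X refl = u∉X u∈σᵤ

  σᵥ-avoids : ¬ Meets σᵥ
  σᵥ-avoids σᵥ-meets = Sum.[ u↛v ∘ component⇒reach , v∉X ] (meets⇒⊆component∪X σᵥ∈S σᵥ-meets v∈σᵥ)

  σᵥ∈B : 0 < mult σᵥ B
  σᵥ∈B = subst (0 <_) (sym (mult-filter-accept (∁? meets?) S σᵥ-avoids)) (∈⇒mult>0 σᵥ∈S)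

  σᵥ≢X : σᵥ ≢ X
  σᵥ≢X refl = v∉X v∈σᵥ

  A-not-cycle : ¬ IsCycle (suc j) A
  A-not-cycle A-cycle = <-irrefl (sym (mult-filter-reject meets? S σᵥ-avoids))
                                 (subst (0 <_) (sym (A≈S σᵥ)) (∈⇒mult>0 σᵥ∈S))
    where
    A≈S : A ≈M S
    A≈S = proj₂ (proj₂ S-circuit) A A⊑S (mult>0⇒NonEmpty σᵤ∈A) A-cycle

  ¬∣X∣≤1+j : ¬ ∣ X ∣ ≤ suc j
  ¬∣X∣≤1+j = A-not-cycle ∘ boundaryWithin⇒cycle (filter⁺ meets? (proj₁ S-cycle)) boundary-A-within-X

  module _ (∣X∣ : ∣ X ∣ ≡ 2 + j) where

    boundary-A : ∀ τ → ∣ τ ∣ ≡ suc j → boundary τ A ≡ boundary τ (X ∷ [])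
    boundary-A = boundaryWithin⇒boundary≡simplex (filter⁺ meets? (proj₁ S-cycle)) boundary-A-within-X ∣X∣ A-not-cycle

    boundary-B : ∀ τ → ∣ τ ∣ ≡ suc j → boundary τ B ≡ boundary τ (X ∷ [])
    boundary-B τ ∣τ∣ = trans (sym (+≡0ℙ⇒≡ (boundary τ A) _ (begin
      boundary τ A ℙ.+ boundary τ B  ≡⟨ sym (ℙ.+-homo-+ (cover τ A) _) ⟩
      parity (cover τ A + cover τ B) ≡⟨ cong parity (sym (count-filter-split (τ ⊆?_) meets? S)) ⟩
      boundary τ S                   ≡⟨ cycle⇒boundary≡0ℙ S-cycle ∣τ∣ ⟩
      0ℙ                             ∎))) (boundary-A τ ∣τ∣)
      where open ≡-Reasoning

    X∷A-cycle : IsCycle (suc j) (X ∷ A)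
    X∷A-cycle = boundary≡⇒cycle-∷ ∣X∣ (filter⁺ meets? (proj₁ S-cycle)) boundary-A

    X∷B-cycle : IsCycle (suc j) (X ∷ B)
    X∷B-cycle = boundary≡⇒cycle-∷ ∣X∣ (filter⁺ (∁? meets?) (proj₁ S-cycle)) boundary-B

    separator-splits : 1 ≤ j →
      IsNonFacialClique (suc j) S X ×
      ∃₂ λ S′ S″ → IsCircuit (suc j) S′ × IsCircuit (suc j) S″ × InterIsSingleton S′ S″ X × IsSymDiff S S′ S″
    separator-splits 1≤j
      with X∉S , X∷A-circuit , X∷B-circuit , X∷A∩X∷B≡X , S≡X∷A△X∷B ←
           circuit-split S-circuit S≡A+B A∩B≡∅ X∉A σᵤ∈A σᵤ≢X σᵥ∈B σᵥ≢X X∷A-cycle X∷B-cycle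
      = (∣X∣ , cycle-∷⇒clique (s≤s 1≤j) ∣X∣ A⊑S X∷A-cycle , X∉S) ,
        (X ∷ A) , (X ∷ B) , X∷A-circuit , X∷B-circuit , X∷A∩X∷B≡X , S≡X∷A△X∷B

-- If V(S) has at most k + 1 vertices, every member of S is V(S), and two copies of V(S) form a subcycle.
nontrivial-circuit-vertices : ∀ {n k} {S : List (Subset n)} → IsCircuit k S → ¬ IsTrivial S → 2 + k ≤ ∣ V S ∣
nontrivial-circuit-vertices {n} {k} {S} (S≢[] , (S-mc , S-even) , S-minimal) ¬trivial with 2 + k ≤? ∣ V S ∣
... | yes 2+k≤∣V∣ = 2+k≤∣V∣
... | no 2+k≰∣V∣ = ⊥-elim (¬trivial (W , λ σ → sym (W∷W≈S σ)))
  where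
  W : Subset n
  W = V S
  S≡W : All (W ≡_) S
  S≡W = All.tabulate λ {σ} σ∈S →
    sym (⊆∧∣q∣≤∣p∣⇒≡ (∈⇒⊆V σ∈S) (subst (∣ W ∣ ≤_) (sym (All.lookup S-mc σ∈S)) (s≤s⁻¹ (≰⇒> 2+k≰∣V∣))))
  ∣member∣ : ∀ T → NonEmpty T → All (W ≡_) T → IsMulticomplex k T → ∣ W ∣ ≡ suc k × 0 < length T
  ∣member∣ []      T≢[] _          _         = ⊥-elim (T≢[] refl)
  ∣member∣ (_ ∷ _) _    (refl ∷ _) (∣σ∣ ∷ _) = ∣σ∣ , s≤s z≤n
  ∣W∣ : ∣ W ∣ ≡ suc k
  ∣W∣ = proj₁ (∣member∣ S S≢[] S≡W S-mc)
  length-even : 2 ∣ length S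
  length-even with a , a∈W ← ∣p∣>0⇒Nonempty {p = W} (subst (0 <_) (sym ∣W∣) (s≤s z≤n)) =
    subst (2 ∣_) (cong length (filter-all ((W - a) ⊆?_) (All.map W-a⊆ S≡W)))
      (S-even (W - a) (suc-injective (trans (sym (x∈p⇒∣p∣≡1+∣p-x∣ a∈W)) ∣W∣)))
    where
    W-a⊆ : ∀ {σ} → W ≡ σ → W - a ⊆ σ
    W-a⊆ refl = x∈p-y⇒x∈p
  W∷W-cycle : IsCycle k (W ∷ W ∷ [])
  W∷W-cycle = (∣W∣ ∷ ∣W∣ ∷ []) , λ τ _ → divides (𝟙 (τ ⊆? W))
    (trans (trans (cover-∷ τ W (W ∷ [])) (cong (𝟙 (τ ⊆? W) +_) (cover-∷ τ W []))) (*-comm 2 (𝟙 (τ ⊆? W))))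
  W∷W⊑S : (W ∷ W ∷ []) ⊑ S
  W∷W⊑S σ with σ ≟S W
  ... | yes refl = subst₂ _≤_ (cong suc (sym (mult-∷-≡ W []))) (sym (cong length (filter-all (W ≟S_) S≡W)))
                     (∣⇒≤ ⦃ >-nonZero (proj₂ (∣member∣ S S≢[] S≡W S-mc)) ⦄ length-even)
  ... | no σ≢W   = subst (_≤ mult σ S) (sym (mult-∷-≢ [] σ≢W)) z≤n
  W∷W≈S : (W ∷ W ∷ []) ≈M S
  W∷W≈S = S-minimal (W ∷ W ∷ []) W∷W⊑S (λ ()) W∷W-cycle

¬[→]⇒×¬ : ∀ {a b} {A : Set a} {B : Set b} → Dec A → ¬ (A → B) → A × ¬ B
¬[→]⇒×¬ (yes a) ¬[A→B] = a , λ b → ¬[A→B] (λ _ → b)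
¬[→]⇒×¬ (no ¬a) ¬[A→B] = ⊥-elim (¬[A→B] (⊥-elim ∘ ¬a))

module _ {S : List (Subset n)} {X : Subset n} where

  Joined : Fin n → Fin n → Set
  Joined u v = u ∈ V S → u ∉ X → v ∈ V S → v ∉ X → Reach S X u v

  joined? : ∀ u v → Dec (Joined u v)
  joined? u v = u ∈? V S →-dec ¬? (u ∈? X) →-dec v ∈? V S →-dec ¬? (v ∈? X) →-dec Component.reach? S X u v

  disconnected⇒separated-pair : ¬ ConnectedAvoiding S X →
    ∃₂ λ u v → u ∈ V S × u ∉ X × v ∈ V S × v ∉ X × ¬ Reach S X u v
  disconnected⇒separated-pair ¬connected
    with u , ¬∀v ← Fin.¬∀⟶∃¬ n _ (λ u → Fin.all? (joined? u)) ¬connected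
    with v , ¬joined ← Fin.¬∀⟶∃¬ n _ (joined? u) ¬∀v
    with u∈V , ¬joined ← ¬[→]⇒×¬ (u ∈? V S) ¬joined
    with u∉X , ¬joined ← ¬[→]⇒×¬ (¬? (u ∈? X)) ¬joined
    with v∈V , ¬joined ← ¬[→]⇒×¬ (v ∈? V S) ¬joined
    with v∉X , u↛v ← ¬[→]⇒×¬ (¬? (v ∈? X)) ¬joined
    = u , v , u∈V , u∉X , v∈V , v∉X , u↛v

lemma3p7 : ∀ {n} (k : ℕ) → 2 ≤ k → (S : List (Subset n)) →
    IsCircuit k S → ¬ IsTrivial S →
    IsConnectedN (ℕ.suc k) S ×
    (∀ X → IsSeparator k S X →
      IsNonFacialClique k S X ×
      ∃₂ λ S' S'' → IsCircuit k S' × IsCircuit k S'' ×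
        InterIsSingleton S' S'' X × IsSymDiff S S' S'')
lemma3p7 (suc zero)    (s≤s ()) _ _ _
lemma3p7 (suc (suc j)) _ S S-circuit ¬trivial = (nontrivial-circuit-vertices S-circuit ¬trivial , connected) , splits
  where
  connected : ∀ X → suc ∣ X ∣ ≤ 3 + j → ConnectedAvoiding S X
  connected X ∣X∣<3+j u v u∈V u∉X v∈V v∉X = decidable-stable (Component.reach? S X u v) λ u↛v →
    Separated.¬∣X∣≤1+j S-circuit u∈V u∉X v∈V v∉X u↛v (s≤s⁻¹ ∣X∣<3+j)
  splits : ∀ X → IsSeparator (2 + j) S X →
    IsNonFacialClique (2 + j) S X ×
    ∃₂ λ S′ S″ → IsCircuit (2 + j) S′ × IsCircuit (2 + j) S″ × InterIsSingleton S′ S″ X × IsSymDiff S S′ S″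
  splits X (_ , ∣X∣ , ¬connected) with u , v , u∈V , u∉X , v∈V , v∉X , u↛v ← disconnected⇒separated-pair ¬connected =
    Separated.separator-splits S-circuit u∈V u∉X v∈V v∉X u↛v ∣X∣ (s≤s z≤n)
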